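{- Let $\mathbf k\in(\mathbb N\cup\{\infty\})^\ell$, let $(\mathbf i_1,\dots,\mathbf i_m)$ be a vector composition and let $r\in\{1,\dots,m\}$ with $\mathbf i_r\le\mathbf k$. Then \[\sum_{\mathbf j\in\mathbb N^\ell,\ \mathbf j\le\mathbf i_r}(-1)^{|\mathbf j|}S^{(\mathbf i_1,\dots,\mathbf i_{r-1},\,\mathbf j,\,\mathbf i_r-\mathbf j,\,\mathbf i_{r+1},\dots,\mathbf i_m)}\in\mathcal I\mathcal O^{\mathbf k},\] where columns equal to $\mathbf 0$ are omitted from the indices.
   Context: Fix $\ell\ge1$; $|\mathbf n|=\sum n_i$, coordinatewise order on $(\mathbb N\cup\{\infty\})^\ell$; vector compositions are sequences of nonzero elements of $\mathbb N^\ell$. $\mathrm{QSym}^{(\ell)}$ is the $\mathbb Q$-span of $M_{\mathbf I}=\sum_{j_1<\dots<j_m}\mathbf x_{j_1}^{\mathbf i_1}\cdots\mathbf x_{j_m}^{\mathbf i_m}$ in commuting variables $x_j^{(i)}$ ($\mathbf x_j^{\mathbf n}=\prod_i(x_j^{(i)})^{n_i}$), a graded Hopf algebra with product of power series and deconcatenation coproduct $\Delta M_{\mathbf I}=\sum_{\mathbf I=\mathbf J\mathbf K}M_{\mathbf J}\otimes M_{\mathbf K}$. $\zeta_{\mathcal Q}(M_{\mathbf I})=1$ if $\mathbf I$ has length $\le1$, else $0$; $\bar\zeta_{\mathcal Q}(h)=(-1)^{|\mathbf n|}\zeta_{\mathcal Q}(h)$ on degree $\mathbf n$; $\zeta_{\mathcal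 Q}^{ -1}$ the convolution inverse. $\mathrm{NSym}^{(\ell)}$ is the graded dual with basis $S^{\mathbf I}$ dual to $M_{\mathbf I}$. $\mathcal I\mathcal O^{\mathbf k}$ is the ideal of $\mathrm{NSym}^{(\ell)}$ generated by $(\bar\zeta_{\mathcal Q})_{\mathbf n}-(\zeta_{\mathcal Q}^{ -1})_{\mathbf n}$ for $\mathbf n\in\mathbb N^\ell$, $\mathbf n\le\mathbf k$ (subscript = restriction to degree $\mathbf n$). -}

module Defs where

open import Data.Nat as ℕ using (ℕ; zero; suc)
open import Data.Bool using (Bool; true; false; if_then_else_)
open import Data.Fin using (Fin)
import Data.Nat.ListAction
open import Data.Vec as Vec using (Vec; []; _∷_; replicate; zipWith; toList)
open import Data.Vec.Properties as VecP using ()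
open import Data.List as List using (List; []; _∷_; _++_; [_]; take; drop; length; upTo; concatMap; filter)
open import Data.List.Properties as ListP using ()
open import Data.List.Relation.Unary.All using (All)
open import Data.Vec.Relation.Binary.Pointwise.Inductive using (Pointwise)
open import Data.Product using (Σ; _×_; _,_)
open import Data.Rational as ℚ using (ℚ; 0ℚ; 1ℚ; _+_; _*_; -_; _-_)
open import Relation.Binary.PropositionalEquality using (_≡_; _≢_)
open import Relation.Nullary using (¬_; yes; no; Dec)
open import Relation.Nullary.Decidable using (⌊_⌋)

Vecℕ : ℕ → Set
Vecℕ ℓ = Vec ℕ ℓ

_≟V_ : ∀ {ℓ} (u v : Vecℕ ℓ) → Dec (u ≡ v)
_≟V_ = VecP.≡-dec ℕ._≟_

_≟L_ : ∀ {ℓ} (I J : List (Vecℕ ℓ)) → Dec (I ≡ J)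
_≟L_ = ListP.≡-dec _≟V_

𝟎 : ∀ {ℓ} → Vecℕ ℓ
𝟎 = replicate _ 0

NonZeroV : ∀ {ℓ} → Vecℕ ℓ → Set
NonZeroV v = v ≢ 𝟎

IsVComp : ∀ {ℓ} → List (Vecℕ ℓ) → Set
IsVComp I = All NonZeroV I

dropZeros : ∀ {ℓ} → List (Vecℕ ℓ) → List (Vecℕ ℓ)
dropZeros [] = []
dropZeros (v ∷ I) with v ≟V 𝟎
... | yes _ = dropZeros I
... | no _  = v ∷ dropZeros I

∣_∣ : ∀ {ℓ} → Vecℕ ℓ → ℕ
∣ v ∣ = Data.Nat.ListAction.sum (toList v)

deg : ∀ {ℓ} → List (Vecℕ ℓ) → Vecℕ ℓ
deg [] = 𝟎
deg (v ∷ I) = zipWith ℕ._+_ v (deg I)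

sgn : ℕ → ℚ
sgn zero = 1ℚ
sgn (suc k) = - sgn k

_≤V_ : ∀ {ℓ} → Vecℕ ℓ → Vecℕ ℓ → Set
u ≤V v = Pointwise ℕ._≤_ u v

data ℕ∞ : Set where
  fin : ℕ → ℕ∞
  ∞   : ℕ∞

data _≤∞_ : ℕ → ℕ∞ → Set where
  ≤fin : ∀ {m n} → m ℕ.≤ n → m ≤∞ fin n
  ≤∞   : ∀ {m} → m ≤∞ ∞

_≤K_ : ∀ {ℓ} → Vecℕ ℓ → Vec ℕ∞ ℓ → Set
u ≤K k = Pointwise _≤∞_ u k

box : ∀ {ℓ} → Vecℕ ℓ → List (Vecℕ ℓ)
box [] = [] ∷ []
box (a ∷ v) = concatMap (λ x → List.map (x ∷_) (box v)) (upTo (suc a))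

_∸V_ : ∀ {ℓ} → Vecℕ ℓ → Vecℕ ℓ → Vecℕ ℓ
u ∸V v = zipWith ℕ._∸_ u v

sumℚ : List ℚ → ℚ
sumℚ = List.foldr _+_ 0ℚ

-- Linear functionals on QSym^(ℓ), given by their values on the
-- monomial basis M_I (I a vector composition).  The graded dual
-- NSym^(ℓ) consists of such functionals; S^I is the functional dual to M_I.

Fun : ℕ → Set
Fun ℓ = List (Vecℕ ℓ) → ℚ

-- convolution (= product of NSym^(ℓ), dual to deconcatenation)
_⋆_ : ∀ {ℓ} → Fun ℓ → Fun ℓ → Fun ℓ
(f ⋆ g) I = sumℚ (List.map (λ i → f (take i I) * g (drop i I)) (upTo (suc (length I))))

-- counit ε (the unit of NSym)
ε : ∀ {ℓ} → Fun ℓ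
ε [] = 1ℚ
ε (_ ∷ _) = 0ℚ

ζQ : ∀ {ℓ} → Fun ℓ
ζQ [] = 1ℚ
ζQ (_ ∷ []) = 1ℚ
ζQ (_ ∷ _ ∷ _) = 0ℚ

ζ̄Q : ∀ {ℓ} → Fun ℓ
ζ̄Q I = sgn ∣ deg I ∣ * ζQ I

restrict : ∀ {ℓ} → Vecℕ ℓ → Fun ℓ → Fun ℓ
restrict n f I with deg I ≟V n
... | yes _ = f I
... | no _  = 0ℚ

IsConvInverse : ∀ {ℓ} → Fun ℓ → Fun ℓ → Set
IsConvInverse φ ψ = (∀ I → (φ ⋆ ψ) I ≡ ε I) × (∀ I → (ψ ⋆ φ) I ≡ ε I)

-- elements of NSym^(ℓ): finite ℚ-linear combinations of the S^I
NSym : ℕ → Set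
NSym ℓ = List (ℚ × List (Vecℕ ℓ))

Sfun : ∀ {ℓ} → List (Vecℕ ℓ) → Fun ℓ
Sfun I J with J ≟L I
... | yes _ = 1ℚ
... | no _  = 0ℚ

⟦_⟧ : ∀ {ℓ} → NSym ℓ → Fun ℓ
⟦ x ⟧ J = sumℚ (List.map (λ { (c , I) → c * Sfun I J }) x)

-- generator (ζ̄_Q)_n − (ζ_Q^{-1})_n, with ψ = ζ_Q^{-1}
gen : ∀ {ℓ} → Fun ℓ → Vecℕ ℓ → Fun ℓ
gen ψ n I = restrict n ζ̄Q I - restrict n ψ I

-- membership in the two-sided ideal IO^k of NSym^(ℓ) generated by
-- the gen ψ n for n ∈ ℕ^ℓ, n ≤ k: x = Σ a_t · gen_{n_t} · b_t,
-- equality of functionals tested on all vector compositions.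
InIO : ∀ {ℓ} → Vec ℕ∞ ℓ → Fun ℓ → NSym ℓ → Set
InIO {ℓ} k ψ x =
  Σ (List (NSym ℓ × Vecℕ ℓ × NSym ℓ)) λ ts →
    All (λ { (a , n , b) → n ≤K k }) ts ×
    (∀ J → IsVComp J →
      ⟦ x ⟧ J ≡ sumℚ (List.map (λ { (a , n , b) → ((⟦ a ⟧ ⋆ gen ψ n) ⋆ ⟦ b ⟧) J }) ts))

element : ∀ {ℓ} → List (Vecℕ ℓ) → Vecℕ ℓ → List (Vecℕ ℓ) → NSym ℓ
element pre v post =
  List.map (λ j → sgn ∣ j ∣ , dropZeros (pre ++ j ∷ (v ∸V j) ∷ post)) (box v)

-- Write Z_w = S^(w) (the empty index when w = 0).  On vector compositions Z_w is
-- the degree-w part (ζ_Q)_w, and (ζ̄_Q)_j = (-1)^{|j|} Z_j.  Concatenating indices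
-- is the product of NSym, so S^(pre, j, v − j, post) = S^pre · Z_j · Z_{v−j} · S^post,
-- and with ψ = ζ_Q^{-1} the ideal element
--   Σ_{j ≤ v} S^pre · ((ζ̄_Q)_j − ψ_j) · (Z_{v−j} · S^post)
-- differs from the given sum by S^pre · (Σ_{j ≤ v} ψ_j · (ζ_Q)_{v−j}) · S^post.
-- The middle factor is the degree-v part of ψ · ζ_Q = ε, which vanishes as v ≠ 0.
module Submission where

open import Defs
open import Data.Nat using (ℕ; zero; suc; s≤s)
import Data.Nat as ℕ
import Data.Nat.Properties as ℕP
open import Data.Vec using (Vec; []; _∷_; zipWith)
import Data.Vec.Properties as VecP
open import Data.Vec.Relation.Binary.Pointwise.Inductive as Pointwise using ([]; _∷_)
open import Data.List as List using (List; []; _∷_; _++_; [_]; take; drop; length; upTo; concatMap)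
import Data.List.Properties as ListP
open import Data.List.Relation.Unary.All as All using (All; []; _∷_)
import Data.List.Relation.Unary.All.Properties as AllP
open import Data.Product using (_×_; _,_)
open import Data.Rational using (ℚ; 0ℚ; 1ℚ; _+_; _*_; -_; _-_)
open import Data.Rational.Properties
open import Data.Maybe using (nothing)
open import Level using (Level)
open import Data.Empty using (⊥-elim)
open import Tactic.RingSolver.Core.AlmostCommutativeRing using (AlmostCommutativeRing; fromCommutativeRing)
open import Tactic.RingSolver using (solve-∀)
open import Relation.Binary.PropositionalEquality using (_≡_; _≢_; refl; sym; trans; cong; cong₂; module ≡-Reasoning)
open import Relation.Nullary using (¬_; yes; no; Dec)
open import Relation.Nullary.Decidable using (_×-dec_)
open ≡-Reasoning

ℚ-ring : AlmostCommutativeRing _ _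
ℚ-ring = fromCommutativeRing +-*-commutativeRing (λ _ → nothing)

private
  variable
    a b : Level
    A : Set a
    B : Set b

when : Dec A → ℚ → ℚ
when (yes _) q = q
when (no _)  q = 0ℚ

when-yes : A → (d : Dec A) (q : ℚ) → when d q ≡ q
when-yes x (yes _) q = refl
when-yes x (no ¬x) q = ⊥-elim (¬x x)

when-no : ¬ A → (d : Dec A) (q : ℚ) → when d q ≡ 0ℚ
when-no ¬x (yes x) q = ⊥-elim (¬x x)
when-no ¬x (no _)  q = refl

when-iff : (A → B) → (B → A) → (da : Dec A) (db : Dec B) (q : ℚ) →
           when da q ≡ when db q
when-iff to from (yes x) db q = sym (when-yes (to x) db q)
when-iff to from (no ¬x) db q = sym (when-no (λ y → ¬x (from y)) db q)

when-× : (da : Dec A) (db : Dec B) (q : ℚ) →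
         when (da ×-dec db) q ≡ when da (when db q)
when-× (yes _) (yes _) q = refl
when-× (yes _) (no _)  q = refl
when-× (no _)  _       q = refl

when-cong : (d : Dec A) {x y : ℚ} → (A → x ≡ y) → when d x ≡ when d y
when-cong (yes x) x≡y = x≡y x
when-cong (no _)  x≡y = refl

when-0 : (d : Dec A) → when d 0ℚ ≡ 0ℚ
when-0 (yes _) = refl
when-0 (no _)  = refl

when-*ʳ : (d : Dec A) (x y : ℚ) → when d x * y ≡ when d (x * y)
when-*ʳ (yes _) x y = refl
when-*ʳ (no _)  x y = *-zeroˡ y

when-*ˡ : (d : Dec A) (x y : ℚ) → x * when d y ≡ when d (x * y)
when-*ˡ (yes _) x y = refl
when-*ˡ (no _)  x y = *-zeroʳ x

restrict-when : ∀ {ℓ} (n : Vecℕ ℓ) (f : Fun ℓ) I → restrict n f I ≡ when (deg I ≟V n) (f I)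
restrict-when n f I with deg I ≟V n
... | yes _ = refl
... | no _  = refl

restrict-cong : ∀ {ℓ} (n : Vecℕ ℓ) {f g : Fun ℓ} I → f I ≡ g I → restrict n f I ≡ restrict n g I
restrict-cong n I fI≡gI with deg I ≟V n
... | yes _ = fI≡gI
... | no _  = refl

∑ : {A : Set} → List A → (A → ℚ) → ℚ
∑ xs f = sumℚ (List.map f xs)

infix 5 ∑
syntax ∑ xs (λ x → f) = ∑[ x ∈ xs ] f

module _ {A : Set} where

  ∑-cong : (xs : List A) {f g : A → ℚ} → (∀ x → f x ≡ g x) → ∑ xs f ≡ ∑ xs g
  ∑-cong []       f≡g = refl
  ∑-cong (x ∷ xs) f≡g = cong₂ _+_ (f≡g x) (∑-cong xs f≡g)

  ∑-++ : (xs ys : List A) (f : A → ℚ) → ∑ (xs ++ ys) f ≡ ∑ xs f + ∑ ys f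
  ∑-++ []       ys f = sym (+-identityˡ _)
  ∑-++ (x ∷ xs) ys f = trans (cong (f x +_) (∑-++ xs ys f)) (sym (+-assoc (f x) _ _))

  ∑-+ : (xs : List A) (f g : A → ℚ) → ∑[ x ∈ xs ] (f x + g x) ≡ ∑ xs f + ∑ xs g
  ∑-+ []       f g = refl
  ∑-+ (x ∷ xs) f g = trans (cong ((f x + g x) +_) (∑-+ xs f g)) (interchange (f x) (g x) _ _)
    where interchange : ∀ a b c d → (a + b) + (c + d) ≡ (a + c) + (b + d)
          interchange = solve-∀ ℚ-ring

  ∑-neg : (xs : List A) (f : A → ℚ) → ∑[ x ∈ xs ] (- f x) ≡ - ∑ xs f
  ∑-neg []       f = refl
  ∑-neg (x ∷ xs) f = trans (cong (- f x +_) (∑-neg xs f)) (sym (neg-distrib-+ (f x) _))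

  ∑-*ˡ : (xs : List A) (c : ℚ) (f : A → ℚ) → ∑[ x ∈ xs ] (c * f x) ≡ c * ∑ xs f
  ∑-*ˡ []       c f = sym (*-zeroʳ c)
  ∑-*ˡ (x ∷ xs) c f = trans (cong (c * f x +_) (∑-*ˡ xs c f)) (sym (*-distribˡ-+ c (f x) _))

  ∑-*ʳ : (xs : List A) (c : ℚ) (f : A → ℚ) → ∑[ x ∈ xs ] (f x * c) ≡ ∑ xs f * c
  ∑-*ʳ []       c f = sym (*-zeroˡ c)
  ∑-*ʳ (x ∷ xs) c f = trans (cong (f x * c +_) (∑-*ʳ xs c f)) (sym (*-distribʳ-+ c (f x) _))

  ∑-0 : (xs : List A) → ∑[ x ∈ xs ] 0ℚ ≡ 0ℚ
  ∑-0 []       = refl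
  ∑-0 (x ∷ xs) = trans (+-identityˡ _) (∑-0 xs)

  ∑-when : ∀ {a} {P : Set a} (d : Dec P) (xs : List A) (f : A → ℚ) →
           ∑[ x ∈ xs ] when d (f x) ≡ when d (∑ xs f)
  ∑-when (yes _) xs f = refl
  ∑-when (no _)  xs f = ∑-0 xs

  ∑-map : {B : Set} (xs : List B) (h : B → A) (f : A → ℚ) → ∑ (List.map h xs) f ≡ ∑[ x ∈ xs ] f (h x)
  ∑-map []       h f = refl
  ∑-map (x ∷ xs) h f = cong (f (h x) +_) (∑-map xs h f)

∑-swap : {A B : Set} (xs : List A) (ys : List B) (F : A → B → ℚ) →
         ∑[ x ∈ xs ] ∑[ y ∈ ys ] F x y ≡ ∑[ y ∈ ys ] ∑[ x ∈ xs ] F x y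
∑-swap []       ys F = sym (∑-0 ys)
∑-swap (x ∷ xs) ys F = trans (cong (∑ ys (F x) +_) (∑-swap xs ys F)) (sym (∑-+ ys (F x) _))

∑-concatMap : {A B : Set} (xs : List A) (h : A → List B) (f : B → ℚ) →
              ∑ (concatMap h xs) f ≡ ∑[ x ∈ xs ] ∑ (h x) f
∑-concatMap []       h f = refl
∑-concatMap (x ∷ xs) h f = trans (∑-++ (h x) (concatMap h xs) f) (cong (∑ (h x) f +_) (∑-concatMap xs h f))

-- The convolution product.  `conv` is the structurally recursive form of `_⋆_`:
-- a splitting of (x ∷ J) either has empty left part, or a left part starting
-- with x.

module _ {ℓ : ℕ} where

  conv : Fun ℓ → Fun ℓ → Fun ℓ
  conv f g []      = f [] * g []
  conv f g (x ∷ J) = f [] * g (x ∷ J) + conv (λ I → f (x ∷ I)) g J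

  ⋆≡conv : ∀ f g J → (f ⋆ g) J ≡ conv f g J
  ⋆≡conv f g []      = +-identityʳ _
  ⋆≡conv f g (x ∷ J) = cong (f [] * g (x ∷ J) +_) (begin
    ∑ (List.applyUpTo suc (suc (length J))) term      ≡⟨ cong (λ is → ∑ is term) (sym (ListP.map-upTo suc (suc (length J)))) ⟩
    ∑ (List.map suc (upTo (suc (length J)))) term     ≡⟨ ∑-map (upTo (suc (length J))) suc term ⟩
    ((λ I → f (x ∷ I)) ⋆ g) J                         ≡⟨ ⋆≡conv (λ I → f (x ∷ I)) g J ⟩
    conv (λ I → f (x ∷ I)) g J                        ∎)
    where
    term : ℕ → ℚ
    term i = f (take i (x ∷ J)) * g (drop i (x ∷ J))

  -- equality of functionals on vector compositions (where they are elements of NSym)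
  _≈_ : Fun ℓ → Fun ℓ → Set
  f ≈ f' = ∀ I → IsVComp I → f I ≡ f' I

  conv-congᵥ : ∀ {f f' g g'} → f ≈ f' → g ≈ g' → conv f g ≈ conv f' g'
  conv-congᵥ f≈f' g≈g' []      []          = cong₂ _*_ (f≈f' [] []) (g≈g' [] [])
  conv-congᵥ f≈f' g≈g' (x ∷ J) (x≢0 ∷ vJ) =
    cong₂ _+_ (cong₂ _*_ (f≈f' [] []) (g≈g' _ (x≢0 ∷ vJ)))
              (conv-congᵥ (λ I vI → f≈f' (x ∷ I) (x≢0 ∷ vI)) g≈g' J vJ)

  conv-cong : ∀ {f f' g g'} → (∀ I → f I ≡ f' I) → (∀ I → g I ≡ g' I) → ∀ J → conv f g J ≡ conv f' g' J
  conv-cong f≡f' g≡g' []      = cong₂ _*_ (f≡f' []) (g≡g' [])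
  conv-cong f≡f' g≡g' (x ∷ J) =
    cong₂ _+_ (cong₂ _*_ (f≡f' []) (g≡g' _)) (conv-cong (λ I → f≡f' (x ∷ I)) g≡g' J)

  conv-0ˡ : ∀ g J → conv (λ _ → 0ℚ) g J ≡ 0ℚ
  conv-0ˡ g []      = *-zeroˡ (g [])
  conv-0ˡ g (x ∷ J) = trans (cong₂ _+_ (*-zeroˡ (g (x ∷ J))) (conv-0ˡ g J)) (+-identityˡ 0ℚ)

  conv-0ʳ : ∀ f J → conv f (λ _ → 0ℚ) J ≡ 0ℚ
  conv-0ʳ f []      = *-zeroʳ (f [])
  conv-0ʳ f (x ∷ J) = trans (cong₂ _+_ (*-zeroʳ (f [])) (conv-0ʳ (λ I → f (x ∷ I)) J)) (+-identityˡ 0ℚ)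

  conv-linearˡ : ∀ c f f' g J → conv (λ I → c * f I + f' I) g J ≡ c * conv f g J + conv f' g J
  conv-linearˡ c f f' g []      = rearrange c (f []) (f' []) (g [])
    where rearrange : ∀ c a b d → (c * a + b) * d ≡ c * (a * d) + b * d
          rearrange = solve-∀ ℚ-ring
  conv-linearˡ c f f' g (x ∷ J) =
    trans (cong ((c * f [] + f' []) * g (x ∷ J) +_) (conv-linearˡ c _ _ g J))
          (rearrange c (f []) (f' []) (g (x ∷ J)) _ _)
    where rearrange : ∀ c a b d e h → (c * a + b) * d + (c * e + h) ≡ c * (a * d + e) + (b * d + h)
          rearrange = solve-∀ ℚ-ring

  conv-linearʳ : ∀ c f g g' J → conv f (λ I → c * g I + g' I) J ≡ c * conv f g J + conv f g' J
  conv-linearʳ c f g g' []      = rearrange c (f []) (g []) (g' [])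
    where rearrange : ∀ c a b d → a * (c * b + d) ≡ c * (a * b) + a * d
          rearrange = solve-∀ ℚ-ring
  conv-linearʳ c f g g' (x ∷ J) =
    trans (cong (f [] * (c * g (x ∷ J) + g' (x ∷ J)) +_) (conv-linearʳ c _ g g' J))
          (rearrange c (f []) (g (x ∷ J)) (g' (x ∷ J)) _ _)
    where rearrange : ∀ c a b d e h → a * (c * b + d) + (c * e + h) ≡ c * (a * b + e) + (a * d + h)
          rearrange = solve-∀ ℚ-ring

  conv-negˡ : ∀ f g J → conv (λ I → - f I) g J ≡ - conv f g J
  conv-negˡ f g []      = sym (neg-distribˡ-* (f []) (g []))
  conv-negˡ f g (x ∷ J) =
    trans (cong ((- f []) * g (x ∷ J) +_) (conv-negˡ _ g J)) (rearrange (f []) (g (x ∷ J)) _)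
    where rearrange : ∀ a b c → (- a) * b + - c ≡ - (a * b + c)
          rearrange = solve-∀ ℚ-ring

  conv-negʳ : ∀ f g J → conv f (λ I → - g I) J ≡ - conv f g J
  conv-negʳ f g []      = sym (neg-distribʳ-* (f []) (g []))
  conv-negʳ f g (x ∷ J) =
    trans (cong (f [] * (- g (x ∷ J)) +_) (conv-negʳ _ g J)) (rearrange (f []) (g (x ∷ J)) _)
    where rearrange : ∀ a b c → a * (- b) + - c ≡ - (a * b + c)
          rearrange = solve-∀ ℚ-ring

  conv-whenˡ : (d : Dec A) → ∀ f g J → conv (λ I → when d (f I)) g J ≡ when d (conv f g J)
  conv-whenˡ (yes _) f g J = refl
  conv-whenˡ (no _)  f g J = conv-0ˡ g J

  conv-∑ˡ : {A : Set} (L : List A) (F : A → Fun ℓ) → ∀ g J →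
            conv (λ I → ∑[ j ∈ L ] F j I) g J ≡ ∑[ j ∈ L ] conv (F j) g J
  conv-∑ˡ L F g []      = sym (∑-*ʳ L (g []) (λ j → F j []))
  conv-∑ˡ L F g (x ∷ J) =
    trans (cong₂ _+_ (sym (∑-*ʳ L (g (x ∷ J)) (λ j → F j []))) (conv-∑ˡ L (λ j I → F j (x ∷ I)) g J))
          (sym (∑-+ L _ _))

  conv-∑ʳ : {A : Set} (L : List A) → ∀ f (G : A → Fun ℓ) J →
            conv f (λ I → ∑[ j ∈ L ] G j I) J ≡ ∑[ j ∈ L ] conv f (G j) J
  conv-∑ʳ L f G []      = sym (∑-*ˡ L (f []) (λ j → G j []))
  conv-∑ʳ L f G (x ∷ J) =
    trans (cong₂ _+_ (sym (∑-*ˡ L (f []) (λ j → G j (x ∷ J)))) (conv-∑ʳ L (λ I → f (x ∷ I)) G J))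
          (sym (∑-+ L _ _))

  conv-assoc : ∀ f g h J → conv (conv f g) h J ≡ conv f (conv g h) J
  conv-assoc f g h []      = *-assoc (f []) (g []) (h [])
  conv-assoc f g h (x ∷ J) = begin
    (f [] * g []) * h (x ∷ J) + conv (λ I → f [] * g (x ∷ I) + conv (λ K → f (x ∷ K)) g I) h J
      ≡⟨ cong ((f [] * g []) * h (x ∷ J) +_) (conv-linearˡ (f []) _ _ h J) ⟩
    (f [] * g []) * h (x ∷ J) + (f [] * conv (λ I → g (x ∷ I)) h J + conv (conv (λ K → f (x ∷ K)) g) h J)
      ≡⟨ cong (λ t → (f [] * g []) * h (x ∷ J) + (f [] * conv (λ I → g (x ∷ I)) h J + t))
              (conv-assoc (λ K → f (x ∷ K)) g h J) ⟩
    (f [] * g []) * h (x ∷ J) + (f [] * conv (λ I → g (x ∷ I)) h J + conv (λ K → f (x ∷ K)) (conv g h) J)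
      ≡⟨ rearrange (f []) (g []) (h (x ∷ J)) _ _ ⟩
    f [] * (g [] * h (x ∷ J) + conv (λ I → g (x ∷ I)) h J) + conv (λ K → f (x ∷ K)) (conv g h) J ∎
    where rearrange : ∀ a b c d e → (a * b) * c + (a * d + e) ≡ a * (b * c + d) + e
          rearrange = solve-∀ ℚ-ring

  Sfun-when : (I J : List (Vecℕ ℓ)) → Sfun I J ≡ when (J ≟L I) 1ℚ
  Sfun-when I J with J ≟L I
  ... | yes _ = refl
  ... | no _  = refl

  Sfun-cons : ∀ p P x I → Sfun (p ∷ P) (x ∷ I) ≡ when (x ≟V p) (Sfun P I)
  Sfun-cons p P x I = begin
    Sfun (p ∷ P) (x ∷ I)                   ≡⟨ Sfun-when (p ∷ P) (x ∷ I) ⟩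
    when ((x ∷ I) ≟L (p ∷ P)) 1ℚ           ≡⟨ when-iff ListP.∷-injective (λ { (refl , refl) → refl }) ((x ∷ I) ≟L (p ∷ P)) ((x ≟V p) ×-dec (I ≟L P)) 1ℚ ⟩
    when ((x ≟V p) ×-dec (I ≟L P)) 1ℚ      ≡⟨ when-× (x ≟V p) (I ≟L P) 1ℚ ⟩
    when (x ≟V p) (when (I ≟L P) 1ℚ)       ≡⟨ cong (when (x ≟V p)) (sym (Sfun-when P I)) ⟩
    when (x ≟V p) (Sfun P I)               ∎

  conv-unitˡ : ∀ g J → conv (Sfun []) g J ≡ g J
  conv-unitˡ g []      = *-identityˡ (g [])
  conv-unitˡ g (x ∷ J) =
    trans (cong (1ℚ * g (x ∷ J) +_) (conv-0ˡ g J)) (trans (+-identityʳ _) (*-identityˡ _))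

  Sfun-++ : ∀ P Q J → Sfun (P ++ Q) J ≡ conv (Sfun P) (Sfun Q) J
  Sfun-++ []      Q J       = sym (conv-unitˡ (Sfun Q) J)
  Sfun-++ (p ∷ P) Q []      = sym (*-zeroˡ (Sfun Q []))
  Sfun-++ (p ∷ P) Q (x ∷ J) = begin
    Sfun (p ∷ P ++ Q) (x ∷ J)                          ≡⟨ Sfun-cons p (P ++ Q) x J ⟩
    when (x ≟V p) (Sfun (P ++ Q) J)                    ≡⟨ cong (when (x ≟V p)) (Sfun-++ P Q J) ⟩
    when (x ≟V p) (conv (Sfun P) (Sfun Q) J)           ≡⟨ sym (conv-whenˡ (x ≟V p) (Sfun P) (Sfun Q) J) ⟩
    conv (λ I → when (x ≟V p) (Sfun P I)) (Sfun Q) J   ≡⟨ conv-cong (λ I → sym (Sfun-cons p P x I)) (λ _ → refl) J ⟩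
    conv (λ I → Sfun (p ∷ P) (x ∷ I)) (Sfun Q) J       ≡⟨ sym (trans (cong (_+ rest) (*-zeroˡ (Sfun Q (x ∷ J)))) (+-identityˡ rest)) ⟩
    conv (Sfun (p ∷ P)) (Sfun Q) (x ∷ J)               ∎
    where
    rest : ℚ
    rest = conv (λ I → Sfun (p ∷ P) (x ∷ I)) (Sfun Q) J

  dropZeros-cons : ∀ (w : Vecℕ ℓ) R → dropZeros (w ∷ R) ≡ dropZeros [ w ] ++ dropZeros R
  dropZeros-cons w R with w ≟V 𝟎
  ... | yes _ = refl
  ... | no _  = refl

  dropZeros-++ : ∀ {P : List (Vecℕ ℓ)} R → IsVComp P → dropZeros (P ++ R) ≡ P ++ dropZeros R
  dropZeros-++ R [] = refl
  dropZeros-++ {w ∷ P} R (w≢0 ∷ vP) with w ≟V 𝟎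
  ... | yes w≡0 = ⊥-elim (w≢0 w≡0)
  ... | no _    = cong (w ∷_) (dropZeros-++ R vP)

  dropZeros-vcomp : ∀ {P : List (Vecℕ ℓ)} → IsVComp P → dropZeros P ≡ P
  dropZeros-vcomp {P} vP = begin
    dropZeros P               ≡⟨ cong dropZeros (sym (ListP.++-identityʳ P)) ⟩
    dropZeros (P ++ [])       ≡⟨ dropZeros-++ [] vP ⟩
    P ++ []                   ≡⟨ ListP.++-identityʳ P ⟩
    P                         ∎

  Z : Vecℕ ℓ → Fun ℓ
  Z w = Sfun (dropZeros [ w ])

  Sfun-dropZeros-cons : ∀ w R J → Sfun (dropZeros (w ∷ R)) J ≡ conv (Z w) (Sfun (dropZeros R)) J
  Sfun-dropZeros-cons w R J =
    trans (cong (λ P → Sfun P J) (dropZeros-cons w R)) (Sfun-++ (dropZeros [ w ]) (dropZeros R) J)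

infixl 6 _+V_
_+V_ : ∀ {ℓ} → Vecℕ ℓ → Vecℕ ℓ → Vecℕ ℓ
_+V_ = zipWith ℕ._+_

deg-++ : ∀ {ℓ} (A B : List (Vecℕ ℓ)) → deg (A ++ B) ≡ deg A +V deg B
deg-++ []      B = sym (VecP.zipWith-identityˡ ℕP.+-identityˡ (deg B))
deg-++ (a ∷ A) B =
  trans (cong (a +V_) (deg-++ A B)) (sym (VecP.zipWith-assoc ℕP.+-assoc a (deg A) (deg B)))

+V≡𝟎⇒≡𝟎 : ∀ {ℓ} (x y : Vecℕ ℓ) → x +V y ≡ 𝟎 → x ≡ 𝟎
+V≡𝟎⇒≡𝟎 []      []      _ = refl
+V≡𝟎⇒≡𝟎 (a ∷ x) (b ∷ y) e =
  cong₂ _∷_ (ℕP.m+n≡0⇒m≡0 a (VecP.∷-injectiveˡ e)) (+V≡𝟎⇒≡𝟎 x y (VecP.∷-injectiveʳ e))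

_≤V?_ : ∀ {ℓ} (u v : Vecℕ ℓ) → Dec (u ≤V v)
u ≤V? v = Pointwise.decidable ℕ._≤?_ u v

≤∸⇒+V : ∀ {ℓ} (a b v : Vecℕ ℓ) → a ≤V v × b ≡ v ∸V a → a +V b ≡ v
≤∸⇒+V [] [] [] _ = refl
≤∸⇒+V (x ∷ a) (y ∷ b) (z ∷ v) (x≤z ∷ a≤v , e) =
  cong₂ _∷_ (trans (cong (x ℕ.+_) (VecP.∷-injectiveˡ e)) (ℕP.m+[n∸m]≡n x≤z))
            (≤∸⇒+V a b v (a≤v , VecP.∷-injectiveʳ e))

+V⇒≤∸ : ∀ {ℓ} (a b v : Vecℕ ℓ) → a +V b ≡ v → a ≤V v × b ≡ v ∸V a
+V⇒≤∸ [] [] [] _ = [] , refl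
+V⇒≤∸ (x ∷ a) (y ∷ b) (z ∷ v) e with +V⇒≤∸ a b v (VecP.∷-injectiveʳ e) | VecP.∷-injectiveˡ e
... | a≤v , b≡v∸a | refl = ℕP.m≤m+n x y ∷ a≤v , cong₂ _∷_ (sym (ℕP.m+n∸m≡n x y)) b≡v∸a

≤V-≤K-trans : ∀ {ℓ} {j v : Vecℕ ℓ} {k : Vec ℕ∞ ℓ} → j ≤V v → v ≤K k → j ≤K k
≤V-≤K-trans []       []            = []
≤V-≤K-trans (p ∷ ps) (≤fin q ∷ qs) = ≤fin (ℕP.≤-trans p q) ∷ ≤V-≤K-trans ps qs
≤V-≤K-trans (p ∷ ps) (≤∞ ∷ qs)     = ≤∞ ∷ ≤V-≤K-trans ps qs

-- The enumeration `box v` of all j ≤ v: each such j occurs exactly once,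
-- expressed as the summation rule  Σ_{j ∈ box v} [d = j]·G j = [d ≤ v]·G d.

∑-upTo-when : ∀ n e (H : ℕ → ℚ) → ∑[ x ∈ upTo n ] when (e ℕ.≟ x) (H x) ≡ when (e ℕ.<? n) (H e)
∑-upTo-when zero    e H = sym (when-no (λ ()) (e ℕ.<? 0) (H e))
∑-upTo-when (suc n) e H = begin
  ∑ (upTo (suc n)) F                                ≡⟨ cong (λ xs → ∑ xs F) (sym (ListP.upTo-∷ʳ n)) ⟩
  ∑ (upTo n ++ [ n ]) F                             ≡⟨ ∑-++ (upTo n) [ n ] F ⟩
  ∑ (upTo n) F + (F n + 0ℚ)                         ≡⟨ cong₂ _+_ (∑-upTo-when n e H) (+-identityʳ (F n)) ⟩
  when (e ℕ.<? n) (H e) + when (e ℕ.≟ n) (H n)      ≡⟨ extend (e ℕ.<? n) (e ℕ.≟ n) ⟩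
  when (e ℕ.<? suc n) (H e)                         ∎
  where
  F : ℕ → ℚ
  F x = when (e ℕ.≟ x) (H x)
  -- e < n + 1 holds iff e < n or e = n, and not both
  extend : (e<n? : Dec (e ℕ.< n)) (e≡n? : Dec (e ≡ n)) →
           when e<n? (H e) + when e≡n? (H n) ≡ when (e ℕ.<? suc n) (H e)
  extend (yes e<n) e≡n? = begin
    H e + when e≡n? (H n)      ≡⟨ cong (H e +_) (when-no (ℕP.<⇒≢ e<n) e≡n? (H n)) ⟩
    H e + 0ℚ                   ≡⟨ +-identityʳ (H e) ⟩
    H e                        ≡⟨ sym (when-yes (ℕP.m<n⇒m<1+n e<n) (e ℕ.<? suc n) (H e)) ⟩
    when (e ℕ.<? suc n) (H e)  ∎
  extend (no _) (yes refl) = trans (+-identityˡ (H e)) (sym (when-yes (ℕP.n<1+n e) (e ℕ.<? suc n) (H e)))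
  extend (no e≮n) (no e≢n) = trans (+-identityˡ 0ℚ) (sym (when-no e≮1+n (e ℕ.<? suc n) (H e)))
    where e≮1+n : ¬ (e ℕ.< suc n)
          e≮1+n e<1+n = e≢n (ℕP.≤-antisym (ℕP.m<1+n⇒m≤n e<1+n) (ℕP.≮⇒≥ e≮n))

∑-box-when : ∀ {ℓ} (v d : Vecℕ ℓ) (G : Vecℕ ℓ → ℚ) →
             ∑[ j ∈ box v ] when (d ≟V j) (G j) ≡ when (d ≤V? v) (G d)
∑-box-when []      []      G = +-identityʳ (G [])
∑-box-when (a ∷ v) (e ∷ d) G = begin
  ∑ (concatMap (λ x → List.map (x ∷_) (box v)) (upTo (suc a))) F
    ≡⟨ ∑-concatMap (upTo (suc a)) (λ x → List.map (x ∷_) (box v)) F ⟩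
  ∑[ x ∈ upTo (suc a) ] ∑ (List.map (x ∷_) (box v)) F
    ≡⟨ ∑-cong (upTo (suc a)) (λ x → trans (∑-map (box v) (x ∷_) F) (column x)) ⟩
  ∑[ x ∈ upTo (suc a) ] when (e ℕ.≟ x) (when (d ≤V? v) (G (x ∷ d)))
    ≡⟨ ∑-upTo-when (suc a) e (λ x → when (d ≤V? v) (G (x ∷ d))) ⟩
  when (e ℕ.<? suc a) (when (d ≤V? v) (G (e ∷ d)))
    ≡⟨ sym (when-× (e ℕ.<? suc a) (d ≤V? v) (G (e ∷ d))) ⟩
  when ((e ℕ.<? suc a) ×-dec (d ≤V? v)) (G (e ∷ d))
    ≡⟨ when-iff (λ { (s≤s e≤a , d≤v) → e≤a ∷ d≤v }) (λ { (e≤a ∷ d≤v) → s≤s e≤a , d≤v })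
                 ((e ℕ.<? suc a) ×-dec (d ≤V? v)) ((e ∷ d) ≤V? (a ∷ v)) (G (e ∷ d)) ⟩
  when ((e ∷ d) ≤V? (a ∷ v)) (G (e ∷ d)) ∎
  where
  F : Vecℕ _ → ℚ
  F j = when ((e ∷ d) ≟V j) (G j)
  column : ∀ x → ∑[ w ∈ box v ] F (x ∷ w) ≡ when (e ℕ.≟ x) (when (d ≤V? v) (G (x ∷ d)))
  column x = begin
    ∑[ w ∈ box v ] F (x ∷ w)
      ≡⟨ ∑-cong (box v) (λ w → trans (when-iff VecP.∷-injective (λ { (refl , refl) → refl })
                                                ((e ∷ d) ≟V (x ∷ w)) ((e ℕ.≟ x) ×-dec (d ≟V w)) (G (x ∷ w)))
                                      (when-× (e ℕ.≟ x) (d ≟V w) (G (x ∷ w)))) ⟩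
    ∑[ w ∈ box v ] when (e ℕ.≟ x) (when (d ≟V w) (G (x ∷ w)))
      ≡⟨ ∑-when (e ℕ.≟ x) (box v) (λ w → when (d ≟V w) (G (x ∷ w))) ⟩
    when (e ℕ.≟ x) (∑[ w ∈ box v ] when (d ≟V w) (G (x ∷ w)))
      ≡⟨ cong (when (e ℕ.≟ x)) (∑-box-when v d (λ w → G (x ∷ w))) ⟩
    when (e ℕ.≟ x) (when (d ≤V? v) (G (x ∷ d))) ∎

box-≤ : ∀ {ℓ} (v : Vecℕ ℓ) → All (_≤V v) (box v)
box-≤ []      = [] ∷ []
box-≤ (a ∷ v) = AllP.concat⁺ (AllP.map⁺ (AllP.applyUpTo⁺₁ (λ i → i) (suc a)
  (λ i<1+a → AllP.map⁺ (All.map (λ j≤v → ℕP.m<1+n⇒m≤n i<1+a ∷ j≤v) (box-≤ v)))))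

module _ {ℓ : ℕ} where

  -- the scalar form: for fixed A, B only j = deg A can contribute
  ∑-box-restrict : ∀ (f g : Fun ℓ) v A B →
    ∑[ j ∈ box v ] restrict j f A * restrict (v ∸V j) g B ≡ when ((deg A +V deg B) ≟V v) (f A * g B)
  ∑-box-restrict f g v A B = begin
    ∑[ j ∈ box v ] restrict j f A * restrict (v ∸V j) g B
      ≡⟨ ∑-cong (box v) (λ j → trans (cong (_* _) (restrict-when j f A)) (when-*ʳ (deg A ≟V j) (f A) _)) ⟩
    ∑[ j ∈ box v ] when (deg A ≟V j) (f A * restrict (v ∸V j) g B)
      ≡⟨ ∑-box-when v (deg A) (λ j → f A * restrict (v ∸V j) g B) ⟩
    when (deg A ≤V? v) (f A * restrict (v ∸V deg A) g B)
      ≡⟨ cong (when (deg A ≤V? v)) (trans (cong (f A *_) (restrict-when (v ∸V deg A) g B))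
                                          (when-*ˡ (deg B ≟V (v ∸V deg A)) (f A) (g B))) ⟩
    when (deg A ≤V? v) (when (deg B ≟V (v ∸V deg A)) (f A * g B))
      ≡⟨ sym (when-× (deg A ≤V? v) (deg B ≟V (v ∸V deg A)) (f A * g B)) ⟩
    when ((deg A ≤V? v) ×-dec (deg B ≟V (v ∸V deg A))) (f A * g B)
      ≡⟨ when-iff (≤∸⇒+V (deg A) (deg B) v) (+V⇒≤∸ (deg A) (deg B) v)
                  ((deg A ≤V? v) ×-dec (deg B ≟V (v ∸V deg A))) ((deg A +V deg B) ≟V v) (f A * g B) ⟩
    when ((deg A +V deg B) ≟V v) (f A * g B) ∎

  restrict-⋆ : ∀ (f g : Fun ℓ) v M →
    ∑[ j ∈ box v ] (restrict j f ⋆ restrict (v ∸V j) g) M ≡ restrict v (f ⋆ g) M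
  restrict-⋆ f g v M = begin
    ∑[ j ∈ box v ] ∑[ i ∈ splits ] restrict j f (take i M) * restrict (v ∸V j) g (drop i M)
      ≡⟨ ∑-swap (box v) splits _ ⟩
    ∑[ i ∈ splits ] ∑[ j ∈ box v ] restrict j f (take i M) * restrict (v ∸V j) g (drop i M)
      ≡⟨ ∑-cong splits (λ i → ∑-box-restrict f g v (take i M) (drop i M)) ⟩
    ∑[ i ∈ splits ] when ((deg (take i M) +V deg (drop i M)) ≟V v) (f (take i M) * g (drop i M))
      ≡⟨ ∑-cong splits (λ i → when-iff (trans (sym (deg-split i))) (trans (deg-split i))
                                   ((deg (take i M) +V deg (drop i M)) ≟V v) (deg M ≟V v) _) ⟩
    ∑[ i ∈ splits ] when (deg M ≟V v) (f (take i M) * g (drop i M))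
      ≡⟨ ∑-when (deg M ≟V v) splits _ ⟩
    when (deg M ≟V v) ((f ⋆ g) M)
      ≡⟨ sym (restrict-when v (f ⋆ g) M) ⟩
    restrict v (f ⋆ g) M ∎
    where
    splits : List ℕ
    splits = upTo (suc (length M))
    deg-split : ∀ i → deg (take i M) +V deg (drop i M) ≡ deg M
    deg-split i = trans (sym (deg-++ (take i M) (drop i M))) (cong deg (ListP.take++drop≡id i M))

  restrict-ε : ∀ {v : Vecℕ ℓ} → v ≢ 𝟎 → ∀ M → restrict v ε M ≡ 0ℚ
  restrict-ε {v} v≢0 []      = trans (restrict-when v ε []) (when-no (λ 𝟎≡v → v≢0 (sym 𝟎≡v)) (𝟎 ≟V v) 1ℚ)
  restrict-ε {v} v≢0 (x ∷ M) = trans (restrict-when v ε (x ∷ M)) (when-0 (deg (x ∷ M) ≟V v))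

  Z-when : ∀ (w : Vecℕ ℓ) {B} → IsVComp B → Z w B ≡ when (deg B ≟V w) (ζQ B)
  Z-when w {B} vB with w ≟V 𝟎
  Z-when w {[]}    _          | yes w≡0 = sym (when-yes (sym w≡0) (𝟎 ≟V w) 1ℚ)
  Z-when w {x ∷ B} (x≢0 ∷ _)  | yes w≡0 =
    sym (trans (when-cong (deg (x ∷ B) ≟V w) (λ e → ⊥-elim (x≢0 (+V≡𝟎⇒≡𝟎 x (deg B) (trans e w≡0)))))
               (when-0 (deg (x ∷ B) ≟V w)))
  Z-when w {[]}    _          | no w≢0 = sym (when-no (λ 𝟎≡w → w≢0 (sym 𝟎≡w)) (𝟎 ≟V w) 1ℚ)
  Z-when w {x ∷ []} _         | no w≢0 = trans (Sfun-when [ w ] [ x ])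
    (when-iff (λ e → trans (VecP.zipWith-identityʳ ℕP.+-identityʳ x) (ListP.∷-injectiveˡ e))
              (λ e → cong [_] (trans (sym (VecP.zipWith-identityʳ ℕP.+-identityʳ x)) e))
              ([ x ] ≟L [ w ]) (deg [ x ] ≟V w) 1ℚ)
  Z-when w {x ∷ y ∷ B} _      | no w≢0 = begin
    Sfun [ w ] (x ∷ y ∷ B)                ≡⟨ Sfun-when [ w ] (x ∷ y ∷ B) ⟩
    when ((x ∷ y ∷ B) ≟L [ w ]) 1ℚ        ≡⟨ when-no (λ ()) ((x ∷ y ∷ B) ≟L [ w ]) 1ℚ ⟩
    0ℚ                                    ≡⟨ sym (when-0 (deg (x ∷ y ∷ B) ≟V w)) ⟩
    when (deg (x ∷ y ∷ B) ≟V w) 0ℚ        ∎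

  Z≈restrict-ζ : ∀ (w : Vecℕ ℓ) → Z w ≈ restrict w ζQ
  Z≈restrict-ζ w B vB = trans (Z-when w vB) (sym (restrict-when w ζQ B))

  restrict-ζ̄ : ∀ (j : Vecℕ ℓ) K → restrict j ζ̄Q K ≡ sgn ∣ j ∣ * restrict j ζQ K
  restrict-ζ̄ j K with deg K ≟V j
  ... | yes refl = refl
  ... | no _     = sym (*-zeroʳ (sgn ∣ j ∣))

  gen≈ : ∀ (ψ : Fun ℓ) j → gen ψ j ≈ (λ K → sgn ∣ j ∣ * Z j K - restrict j ψ K)
  gen≈ ψ j K vK = cong (_- restrict j ψ K)
    (trans (restrict-ζ̄ j K) (cong (sgn ∣ j ∣ *_) (sym (Z≈restrict-ζ j K vK))))

  -- Σ_{j ≤ v} ψ_j · Z_{v−j} is the degree-v part of ψ · ζ_Q; for ψ = ζ_Q^{-1}, v ≠ 0 it vanishes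
  ∑-inverse-Z : ∀ (ψ : Fun ℓ) → (∀ I → (ψ ⋆ ζQ) I ≡ ε I) → ∀ {v : Vecℕ ℓ} → v ≢ 𝟎 →
    (λ M → ∑[ j ∈ box v ] conv (restrict j ψ) (Z (v ∸V j)) M) ≈ (λ _ → 0ℚ)
  ∑-inverse-Z ψ ψ⋆ζ≡ε {v} v≢0 M vM = begin
    ∑[ j ∈ box v ] conv (restrict j ψ) (Z (v ∸V j)) M
      ≡⟨ ∑-cong (box v) (λ j → conv-congᵥ (λ _ _ → refl) (Z≈restrict-ζ (v ∸V j)) M vM) ⟩
    ∑[ j ∈ box v ] conv (restrict j ψ) (restrict (v ∸V j) ζQ) M
      ≡⟨ ∑-cong (box v) (λ j → sym (⋆≡conv (restrict j ψ) (restrict (v ∸V j) ζQ) M)) ⟩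
    ∑[ j ∈ box v ] (restrict j ψ ⋆ restrict (v ∸V j) ζQ) M
      ≡⟨ restrict-⋆ ψ ζQ v M ⟩
    restrict v (ψ ⋆ ζQ) M
      ≡⟨ restrict-cong v M (ψ⋆ζ≡ε M) ⟩
    restrict v ε M
      ≡⟨ restrict-ε v≢0 M ⟩
    0ℚ ∎

-- The explicit decomposition of the element into generators of IO^k:
--   Σ_{j ≤ v} (-1)^{|j|} S^(pre,j,v−j,post) = Σ_{j ≤ v} S^pre · gen_j · S^((v−j),post).

module Decomposition {ℓ} (ψ : Fun ℓ) (ψ⋆ζ≡ε : ∀ I → (ψ ⋆ ζQ) I ≡ ε I)
                     (pre : List (Vecℕ ℓ)) (v : Vecℕ ℓ) (post : List (Vecℕ ℓ))
                     (pre-vc : IsVComp pre) (v≢0 : v ≢ 𝟎) (post-vc : IsVComp post) where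

  left : NSym ℓ
  left = (1ℚ , pre) ∷ []

  right : Vecℕ ℓ → NSym ℓ
  right j = (1ℚ , dropZeros ((v ∸V j) ∷ post)) ∷ []

  terms : List (NSym ℓ × Vecℕ ℓ × NSym ℓ)
  terms = List.map (λ j → left , j , right j) (box v)

  W : Vecℕ ℓ → Fun ℓ
  W j = conv (Z (v ∸V j)) (Sfun post)

  ⟦single⟧ : ∀ (P : List (Vecℕ ℓ)) J → ⟦ (1ℚ , P) ∷ [] ⟧ J ≡ Sfun P J
  ⟦single⟧ P J = trans (+-identityʳ _) (*-identityˡ _)

  S-right : ∀ j J → Sfun (dropZeros ((v ∸V j) ∷ post)) J ≡ W j J
  S-right j J = trans (Sfun-dropZeros-cons (v ∸V j) post J)
                      (cong (λ P → conv (Z (v ∸V j)) (Sfun P) J) (dropZeros-vcomp post-vc))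

  ⟦right⟧ : ∀ j J → ⟦ right j ⟧ J ≡ W j J
  ⟦right⟧ j J = trans (⟦single⟧ _ J) (S-right j J)

  S-term : ∀ j J → Sfun (dropZeros (pre ++ j ∷ (v ∸V j) ∷ post)) J ≡ conv (Sfun pre) (conv (Z j) (W j)) J
  S-term j J = begin
    Sfun (dropZeros (pre ++ j ∷ (v ∸V j) ∷ post)) J
      ≡⟨ cong (λ P → Sfun P J) (dropZeros-++ (j ∷ (v ∸V j) ∷ post) pre-vc) ⟩
    Sfun (pre ++ dropZeros (j ∷ (v ∸V j) ∷ post)) J
      ≡⟨ Sfun-++ pre _ J ⟩
    conv (Sfun pre) (Sfun (dropZeros (j ∷ (v ∸V j) ∷ post))) J
      ≡⟨ conv-cong (λ _ → refl) (λ K → trans (Sfun-dropZeros-cons j ((v ∸V j) ∷ post) K)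
                                             (conv-cong (λ _ → refl) (S-right j) K)) J ⟩
    conv (Sfun pre) (conv (Z j) (W j)) J ∎

  X Y : Vecℕ ℓ → Fun ℓ
  X j = conv (Sfun pre) (conv (Z j) (W j))
  Y j = conv (Sfun pre) (conv (restrict j ψ) (W j))

  generator-term : ∀ j J → IsVComp J → ((⟦ left ⟧ ⋆ gen ψ j) ⋆ ⟦ right j ⟧) J ≡ sgn ∣ j ∣ * X j J - Y j J
  generator-term j J vJ = begin
    ((⟦ left ⟧ ⋆ gen ψ j) ⋆ ⟦ right j ⟧) J
      ≡⟨ ⋆≡conv (⟦ left ⟧ ⋆ gen ψ j) ⟦ right j ⟧ J ⟩
    conv (⟦ left ⟧ ⋆ gen ψ j) ⟦ right j ⟧ J
      ≡⟨ conv-cong left-gen (⟦right⟧ j) J ⟩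
    conv (conv (Sfun pre) (gen ψ j)) (W j) J
      ≡⟨ conv-assoc (Sfun pre) (gen ψ j) (W j) J ⟩
    conv (Sfun pre) (conv (gen ψ j) (W j)) J
      ≡⟨ conv-congᵥ (λ _ _ → refl) expand J vJ ⟩
    conv (Sfun pre) (λ I → sgn ∣ j ∣ * conv (Z j) (W j) I - conv (restrict j ψ) (W j) I) J
      ≡⟨ conv-linearʳ (sgn ∣ j ∣) (Sfun pre) (conv (Z j) (W j)) (λ I → - conv (restrict j ψ) (W j) I) J ⟩
    sgn ∣ j ∣ * X j J + conv (Sfun pre) (λ I → - conv (restrict j ψ) (W j) I) J
      ≡⟨ cong (sgn ∣ j ∣ * X j J +_) (conv-negʳ (Sfun pre) (conv (restrict j ψ) (W j)) J) ⟩
    sgn ∣ j ∣ * X j J - Y j J ∎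
    where
    left-gen : ∀ I → (⟦ left ⟧ ⋆ gen ψ j) I ≡ conv (Sfun pre) (gen ψ j) I
    left-gen I = trans (⋆≡conv ⟦ left ⟧ (gen ψ j) I) (conv-cong (⟦single⟧ pre) (λ _ → refl) I)
    expand : conv (gen ψ j) (W j) ≈ (λ I → sgn ∣ j ∣ * conv (Z j) (W j) I - conv (restrict j ψ) (W j) I)
    expand I vI = begin
      conv (gen ψ j) (W j) I
        ≡⟨ conv-congᵥ (gen≈ ψ j) (λ _ _ → refl) I vI ⟩
      conv (λ K → sgn ∣ j ∣ * Z j K - restrict j ψ K) (W j) I
        ≡⟨ conv-linearˡ (sgn ∣ j ∣) (Z j) (λ K → - restrict j ψ K) (W j) I ⟩
      sgn ∣ j ∣ * conv (Z j) (W j) I + conv (λ K → - restrict j ψ K) (W j) I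
        ≡⟨ cong (sgn ∣ j ∣ * conv (Z j) (W j) I +_) (conv-negˡ (restrict j ψ) (W j) I) ⟩
      sgn ∣ j ∣ * conv (Z j) (W j) I - conv (restrict j ψ) (W j) I ∎

  ∑-correction : ∀ J → IsVComp J → ∑[ j ∈ box v ] Y j J ≡ 0ℚ
  ∑-correction J vJ = begin
    ∑[ j ∈ box v ] conv (Sfun pre) (conv (restrict j ψ) (W j)) J
      ≡⟨ sym (conv-∑ʳ (box v) (Sfun pre) (λ j → conv (restrict j ψ) (W j)) J) ⟩
    conv (Sfun pre) (λ I → ∑[ j ∈ box v ] conv (restrict j ψ) (W j) I) J
      ≡⟨ conv-congᵥ (λ _ _ → refl) middle J vJ ⟩
    conv (Sfun pre) (λ _ → 0ℚ) J
      ≡⟨ conv-0ʳ (Sfun pre) J ⟩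
    0ℚ ∎
    where
    middle : (λ I → ∑[ j ∈ box v ] conv (restrict j ψ) (W j) I) ≈ (λ _ → 0ℚ)
    middle I vI = begin
      ∑[ j ∈ box v ] conv (restrict j ψ) (W j) I
        ≡⟨ ∑-cong (box v) (λ j → sym (conv-assoc (restrict j ψ) (Z (v ∸V j)) (Sfun post) I)) ⟩
      ∑[ j ∈ box v ] conv (conv (restrict j ψ) (Z (v ∸V j))) (Sfun post) I
        ≡⟨ sym (conv-∑ˡ (box v) (λ j → conv (restrict j ψ) (Z (v ∸V j))) (Sfun post) I) ⟩
      conv (λ K → ∑[ j ∈ box v ] conv (restrict j ψ) (Z (v ∸V j)) K) (Sfun post) I
        ≡⟨ conv-congᵥ (∑-inverse-Z ψ ψ⋆ζ≡ε v≢0) (λ _ _ → refl) I vI ⟩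
      conv (λ _ → 0ℚ) (Sfun post) I
        ≡⟨ conv-0ˡ (Sfun post) I ⟩
      0ℚ ∎

  element≡terms : ∀ J → IsVComp J →
    ⟦ element pre v post ⟧ J ≡ sumℚ (List.map (λ { (a , n , b) → ((⟦ a ⟧ ⋆ gen ψ n) ⋆ ⟦ b ⟧) J }) terms)
  element≡terms J vJ = begin
    ⟦ element pre v post ⟧ J
      ≡⟨ ∑-map (box v) (λ j → sgn ∣ j ∣ , dropZeros (pre ++ j ∷ (v ∸V j) ∷ post)) (λ { (c , I) → c * Sfun I J }) ⟩
    ∑[ j ∈ box v ] sgn ∣ j ∣ * Sfun (dropZeros (pre ++ j ∷ (v ∸V j) ∷ post)) J
      ≡⟨ ∑-cong (box v) (λ j → cong (sgn ∣ j ∣ *_) (S-term j J)) ⟩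
    ΣX
      ≡⟨ sym (+-identityʳ ΣX) ⟩
    ΣX + - 0ℚ
      ≡⟨ cong (λ t → ΣX + - t) (sym (∑-correction J vJ)) ⟩
    ΣX + - (∑[ j ∈ box v ] Y j J)
      ≡⟨ cong (ΣX +_) (sym (∑-neg (box v) (λ j → Y j J))) ⟩
    ΣX + (∑[ j ∈ box v ] - Y j J)
      ≡⟨ sym (∑-+ (box v) (λ j → sgn ∣ j ∣ * X j J) (λ j → - Y j J)) ⟩
    ∑[ j ∈ box v ] (sgn ∣ j ∣ * X j J - Y j J)
      ≡⟨ sym (∑-cong (box v) (λ j → generator-term j J vJ)) ⟩
    ∑[ j ∈ box v ] ((⟦ left ⟧ ⋆ gen ψ j) ⋆ ⟦ right j ⟧) J
      ≡⟨ sym (∑-map (box v) (λ j → left , j , right j) (λ { (a , n , b) → ((⟦ a ⟧ ⋆ gen ψ n) ⋆ ⟦ b ⟧) J })) ⟩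
    sumℚ (List.map (λ { (a , n , b) → ((⟦ a ⟧ ⋆ gen ψ n) ⋆ ⟦ b ⟧) J }) terms) ∎
    where
    ΣX : ℚ
    ΣX = ∑[ j ∈ box v ] sgn ∣ j ∣ * X j J

  terms-bounded : ∀ {k} → v ≤K k → All (λ { (a , n , b) → n ≤K k }) terms
  terms-bounded v≤k = AllP.map⁺ (All.map (λ j≤v → ≤V-≤K-trans j≤v v≤k) (box-≤ v))

-- The terms above witness membership in IO^k.
corollary5p12 : (ℓ : ℕ) → 1 Data.Nat.≤ ℓ → (k : Vec ℕ∞ ℓ)
    → (ψ : Fun ℓ) → IsConvInverse ζQ ψ
    → (pre : List (Vecℕ ℓ)) (v : Vecℕ ℓ) (post : List (Vecℕ ℓ))
    → IsVComp (pre ++ v ∷ post)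
    → v ≤K k
    → InIO k ψ (element pre v post)
corollary5p12 ℓ _ k ψ (_ , ψ⋆ζ≡ε) pre v post vcomp v≤k with AllP.++⁻ pre vcomp
... | pre-vc , v≢0 ∷ post-vc = terms , terms-bounded v≤k , element≡terms
  where open Decomposition ψ ψ⋆ζ≡ε pre v post pre-vc v≢0 post-vc
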